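{- Let $V$ be a finite set with $|V|=n\ge1$, let $\Gamma\in\mathbb{N}^V$ and $\mu=\frac1n\sum_{v\in V}\Gamma(v)$. If $\min_{v\in V}\Gamma(v)\ge\mu-1$, then the set $S'(\Gamma)=\{v\in V:\Gamma(v)\le\lceil\mu\rfloor\}$ satisfies $|S'(\Gamma)|\ge n/3$.
   Context: For $x\in\mathbb{R}$, $\lceil x\rfloor:=\lceil x-1/2\rceil$ denotes rounding to the nearest integer. -}

module Defs where

open import Data.Nat using (ℕ; NonZero)
open import Data.Integer using (ℤ; +_)
import Data.Integer as ℤ
open import Data.Rational using (ℚ; _/_; _-_; ½; ceiling)
open import Data.Fin using (Fin)
open import Data.List using (List; map; filter; length; allFin)
open import Data.Nat.ListAction using (sum)

-- ⌈x⌋ := ⌈x - 1/2⌉ (rounding to nearest integer, halves rounded down)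
⌈_⌋ : ℚ → ℤ
⌈ x ⌋ = ceiling (x - ½)

total : ∀ {n} → (Fin n → ℕ) → ℕ
total {n} Γ = sum (map Γ (allFin n))

mean : ∀ n → .{{_ : NonZero n}} → (Fin n → ℕ) → ℚ
mean n Γ = (+ total Γ) / n

-- S'(Γ) = { v ∈ V : Γ(v) ≤ ⌈μ⌋ }, as a list of its (distinct) elements
S′ : ∀ n → .{{_ : NonZero n}} → (Fin n → ℕ) → List (Fin n)
S′ n Γ = filter (λ v → (+ Γ v) ℤ.≤? ⌈ mean n Γ ⌋) (allFin n)

{-# OPTIONS --safe #-}
-- Write t = Σ Γ and k = |S′(Γ)|. The hypothesis Γ(v) ≥ μ − 1 reads 2nΓ(v) ≥ (2t + n) − 3n, and
-- for v ∉ S′ integrality gives Γ(v) ≥ ⌈μ⌋ + 1 ≥ μ + 1/2, i.e. 2nΓ(v) ≥ 2t + n. Summing over V,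
-- 2nt = Σ 2nΓ(v) ≥ n(2t + n) − 3nk, hence 3k ≥ n.
module Submission where

open import Defs
open import Data.Nat using (ℕ; NonZero)
open import Data.Integer using (+_)
open import Data.Rational using (_≤_; _-_; _/_; 1ℚ)
open import Data.Fin using (Fin)
open import Data.List using (length)

open import Level using (Level)
open import Data.Nat using (suc; z≤n; _+_; _*_)
import Data.Nat as ℕ
import Data.Nat.Properties as ℕ
open import Data.Nat.ListAction using (sum)
import Data.Nat.Tactic.RingSolver as ℕ-Solver
import Data.Integer as ℤ
import Data.Integer.Properties as ℤ
open import Data.Integer.DivMod using ([n/d]*d≤n)
import Data.Integer.Tactic.RingSolver as ℤ-Solver
open import Data.Rational using (-_; ½; ceiling; floor; toℚᵘ; ↥_; ↧_)
open import Data.Rational.Properties using (toℚᵘ-fromℚᵘ; toℚᵘ-homo-+; toℚᵘ-homo‿-; toℚᵘ-mono-≤; toℚᵘ-cancel-≤)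
open import Data.Rational.Unnormalised as ℚᵘ using (mkℚᵘ; *≤*; _≃_) renaming (_≤_ to _≤ᵘ_; _/_ to _/ᵘ_)
import Data.Rational.Unnormalised.Properties as ℚᵘ
open import Data.List using ([]; _∷_; map; filter; allFin)
open import Data.List.Properties using (length-tabulate)
open import Function using (id)
open import Relation.Binary.PropositionalEquality using (_≡_; sym; cong; subst; subst₂)
open import Relation.Nullary using (¬_; yes; no)
open import Relation.Unary using (Pred; Decidable)

floor-≤ : ∀ p → mkℚᵘ (floor p) 0 ≤ᵘ toℚᵘ p
floor-≤ p@record{} = *≤* (begin
  floor p ℤ.* ↧ p  ≤⟨ [n/d]*d≤n (↥ p) (↧ p) ⟩
  ↥ p              ≡⟨ ℤ.*-identityʳ (↥ p) ⟨
  ↥ p ℤ.* + 1      ∎)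
  where open ℤ.≤-Reasoning

≤-ceiling : ∀ p → toℚᵘ p ≤ᵘ mkℚᵘ (ceiling p) 0
≤-ceiling p@record{} = ℚᵘ.neg-cancel-≤ (begin
  mkℚᵘ (ℤ.- (ℤ.- floor (- p))) 0  ≡⟨ cong (λ i → mkℚᵘ i 0) (ℤ.neg-involutive _) ⟩
  mkℚᵘ (floor (- p)) 0            ≤⟨ floor-≤ (- p) ⟩
  toℚᵘ (- p)                      ≃⟨ toℚᵘ-homo‿- p ⟩
  ℚᵘ.- toℚᵘ p                     ∎)
  where open ℚᵘ.≤-Reasoning

toℚᵘ-/ : ∀ a n .{{_ : NonZero n}} → toℚᵘ (a / n) ≃ a /ᵘ n
toℚᵘ-/ a n@(suc _) = toℚᵘ-fromℚᵘ (a /ᵘ n)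

toℚᵘ-/-sub : ∀ a n .{{_ : NonZero n}} q → toℚᵘ (a / n - q) ≃ a /ᵘ n ℚᵘ.- toℚᵘ q
toℚᵘ-/-sub a n q = ℚᵘ.≃-trans (toℚᵘ-homo-+ (a / n) (- q)) (ℚᵘ.+-cong (toℚᵘ-/ a n) (toℚᵘ-homo‿- q))

a/n-1≤g⇒a≤ng+n : ∀ a n .{{_ : NonZero n}} g → (+ a) / n - 1ℚ ≤ (+ g) / 1 → a ℕ.≤ n * g + n
a/n-1≤g⇒a≤ng+n a n@(suc _) g h
  with ℚᵘ.≤-respʳ-≃ (toℚᵘ-/ (+ g) 1) (ℚᵘ.≤-respˡ-≃ (toℚᵘ-/-sub (+ a) n 1ℚ) (toℚᵘ-mono-≤ h))
... | *≤* le = ℤ.drop‿+≤+ (begin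
  + a                                                  ≡⟨ shift (+ a) (+ n) ⟩
  (+ a ℤ.* + 1 ℤ.+ ℤ.- + 1 ℤ.* + n) ℤ.* + 1 ℤ.+ + n  ≤⟨ ℤ.+-monoˡ-≤ (+ n) le ⟩
  + g ℤ.* (+ n ℤ.* + 1) ℤ.+ + n                       ≡⟨ tidy (+ g) (+ n) ⟩
  + n ℤ.* + g ℤ.+ + n                                 ≡⟨ cong (ℤ._+ + n) (ℤ.pos-* n g) ⟨
  + (n * g) ℤ.+ + n                                   ≡⟨ ℤ.pos-+ (n * g) n ⟨
  + (n * g + n)                                       ∎)
  where
  open ℤ.≤-Reasoning
  shift : ∀ A N → A ≡ (A ℤ.* + 1 ℤ.+ ℤ.- + 1 ℤ.* N) ℤ.* + 1 ℤ.+ N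
  shift = ℤ-Solver.solve-∀
  tidy : ∀ G N → G ℤ.* (N ℤ.* + 1) ℤ.+ N ≡ N ℤ.* G ℤ.+ N
  tidy = ℤ-Solver.solve-∀

⌈a/n⌋<g⇒2a+n≤2ng : ∀ a n .{{_ : NonZero n}} g → ⌈ (+ a) / n ⌋ ℤ.< + g → 2 * a + n ℕ.≤ 2 * n * g
⌈a/n⌋<g⇒2a+n≤2ng a n@(suc _) g c<g
  with ℚᵘ.≤-respˡ-≃ (toℚᵘ-/-sub (+ a) n ½) (≤-ceiling ((+ a) / n - ½))
... | *≤* le = ℤ.drop‿+≤+ (begin
  + (2 * a + n)                                                  ≡⟨ ℤ.pos-+ (2 * a) n ⟩
  + (2 * a) ℤ.+ + n                                              ≡⟨ cong (ℤ._+ + n) (ℤ.pos-* 2 a) ⟩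
  + 2 ℤ.* + a ℤ.+ + n                                            ≡⟨ shift (+ a) (+ n) ⟩
  (+ a ℤ.* + 2 ℤ.+ ℤ.- + 1 ℤ.* + n) ℤ.* + 1 ℤ.+ + 2 ℤ.* + n     ≤⟨ ℤ.+-monoˡ-≤ (+ 2 ℤ.* + n) le ⟩
  c ℤ.* (+ n ℤ.* + 2) ℤ.+ + 2 ℤ.* + n                            ≡⟨ tidy c (+ n) ⟩
  + 2 ℤ.* + n ℤ.* ℤ.suc c                                        ≤⟨ ℤ.*-monoˡ-≤-nonNeg (+ 2 ℤ.* + n) (ℤ.i<j⇒suc[i]≤j c<g) ⟩
  + 2 ℤ.* + n ℤ.* + g                                            ≡⟨ cong (ℤ._* + g) (ℤ.pos-* 2 n) ⟨
  + (2 * n) ℤ.* + g                                              ≡⟨ ℤ.pos-* (2 * n) g ⟨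
  + (2 * n * g)                                                  ∎)
  where
  c = ⌈ (+ a) / n ⌋
  open ℤ.≤-Reasoning
  shift : ∀ A N → + 2 ℤ.* A ℤ.+ N ≡ (A ℤ.* + 2 ℤ.+ ℤ.- + 1 ℤ.* N) ℤ.* + 1 ℤ.+ + 2 ℤ.* N
  shift = ℤ-Solver.solve-∀
  tidy : ∀ C N → C ℤ.* (N ℤ.* + 2) ℤ.+ + 2 ℤ.* N ≡ + 2 ℤ.* N ℤ.* (+ 1 ℤ.+ C)
  tidy = ℤ-Solver.solve-∀

ad≤bc⇒a/c≤b/d : ∀ a b c d .{{_ : NonZero c}} .{{_ : NonZero d}} → a * d ℕ.≤ b * c → (+ a) / c ≤ (+ b) / d
ad≤bc⇒a/c≤b/d a b c@(suc _) d@(suc _) ad≤bc = toℚᵘ-cancel-≤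
  (ℚᵘ.≤-respˡ-≃ (ℚᵘ.≃-sym (toℚᵘ-/ (+ a) c)) (ℚᵘ.≤-respʳ-≃ (ℚᵘ.≃-sym (toℚᵘ-/ (+ b) d))
    (*≤* (subst₂ ℤ._≤_ (ℤ.pos-* a d) (ℤ.pos-* b c) (ℤ.+≤+ ad≤bc)))))

module _ {a p : Level} {A : Set a} {P : Pred A p} (P? : Decidable P) (f : A → ℕ) (m d : ℕ) {K : ℕ}
         (bound : ∀ x → K ℕ.≤ m * f x + d) (bound-∉ : ∀ x → ¬ P x → K ℕ.≤ m * f x) where

  length*≤sum+count : ∀ xs → length xs * K ℕ.≤ m * sum (map f xs) + d * length (filter P? xs)
  length*≤sum+count []       = z≤n
  length*≤sum+count (x ∷ xs) with P? x
  ... | yes _  = ℕ.≤-trans (ℕ.+-mono-≤ (bound x) (length*≤sum+count xs))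
                           (ℕ.≤-reflexive (regroup-∈ m (f x) _ d _))
    where
    regroup-∈ : ∀ m F S d C → m * F + d + (m * S + d * C) ≡ m * (F + S) + d * (1 + C)
    regroup-∈ = ℕ-Solver.solve-∀
  ... | no ¬px = ℕ.≤-trans (ℕ.+-mono-≤ (bound-∉ x ¬px) (length*≤sum+count xs))
                           (ℕ.≤-reflexive (regroup-∉ m (f x) _ d _))
    where
    regroup-∉ : ∀ m F S d C → m * F + (m * S + d * C) ≡ m * (F + S) + d * C
    regroup-∉ = ℕ-Solver.solve-∀

lemma5 : (n : ℕ) → .{{_ : NonZero n}} → (Γ : Fin n → ℕ)
         → (∀ v → mean n Γ - 1ℚ ≤ (+ Γ v) / 1)
         → (+ n) / 3 ≤ (+ length (S′ n Γ)) / 1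
lemma5 n Γ hyp = ad≤bc⇒a/c≤b/d n k 3 1 (subst₂ ℕ._≤_ (sym (ℕ.*-identityʳ n)) (ℕ.*-comm 3 k) n≤3k)
  where
  t = total Γ
  k = length (S′ n Γ)
  K = 2 * t + n

  bound : ∀ v → K ℕ.≤ 2 * n * Γ v + 3 * n
  bound v = ℕ.≤-trans (ℕ.+-monoˡ-≤ n (ℕ.*-monoʳ-≤ 2 (a/n-1≤g⇒a≤ng+n t n (Γ v) (hyp v))))
                      (ℕ.≤-reflexive (expand n (Γ v)))
    where
    expand : ∀ n g → 2 * (n * g + n) + n ≡ 2 * n * g + 3 * n
    expand = ℕ-Solver.solve-∀

  bound-∉ : ∀ v → ¬ (+ Γ v ℤ.≤ ⌈ mean n Γ ⌋) → K ℕ.≤ 2 * n * Γ v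
  bound-∉ v Γv≰⌈μ⌋ = ⌈a/n⌋<g⇒2a+n≤2ng t n (Γ v) (ℤ.≰⇒> Γv≰⌈μ⌋)

  summed : n * K ℕ.≤ 2 * n * t + 3 * n * k
  summed = subst (λ L → L * K ℕ.≤ 2 * n * t + 3 * n * k) (length-tabulate {n = n} id)
    (length*≤sum+count (λ v → + Γ v ℤ.≤? ⌈ mean n Γ ⌋) Γ (2 * n) (3 * n) bound bound-∉ (allFin n))

  n≤3k : n ℕ.≤ 3 * k
  n≤3k = ℕ.*-cancelˡ-≤ n (ℕ.+-cancelˡ-≤ (2 * n * t) _ _ (subst₂ ℕ._≤_ (expandˡ n t) (expandʳ n t k) summed))
    where
    expandˡ : ∀ n t → n * (2 * t + n) ≡ 2 * n * t + n * n
    expandˡ = ℕ-Solver.solve-∀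
    expandʳ : ∀ n t k → 2 * n * t + 3 * n * k ≡ 2 * n * t + n * (3 * k)
    expandʳ = ℕ-Solver.solve-∀
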